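{- Let $G$ be a graph and let $m_j:=\mathrm{maxObs}(G;j)$ for each $j\in\{0,1,\dots,\gamma_P(G)\}$. For each $i\in\{1,\dots,\gamma_P(G)-1\}$, the size $i$ is useful if and only if \[ \max_{0\le j<i}\frac{i-j}{m_i-m_j}<\min_{i<j\le\gamma_P(G)}\frac{j-i}{m_j-m_i}. \]
   Context: Graphs are finite and simple. Power domination: from $S\subseteq V(G)$, first $N[S]$ is observed; then repeatedly, while an observed vertex has exactly one unobserved neighbor, that neighbor becomes observed; the final set is $\mathrm{Obs}(G;S)$. $\gamma_P(G)$ is the least $|S|$ with $\mathrm{Obs}(G;S)=V(G)$. $\mathrm{maxObs}(G;k):=\max_{S\subseteq V(G),|S|=k}|\mathrm{Obs}(G;S)|$. For $\beta\ge0$, $\mathrm{C}(G;S,\beta)=|S|+\beta(|V(G)|-|\mathrm{Obs}(G;S)|)$; $S$ is $\beta$-best if it minimizes $\mathrm{C}(G;\cdot,\beta)$ over all subsets of $V(G)$. A set $S$ is useful if there is a non-degenerate interval $I$ such that $S$ is $\beta$-best for all $\beta\in I$; an integer $k\in\{0,\dots,\gamma_P(G)\}$ is a useful size if some useful set has size $k$.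
   Formalization: The parameter β and the endpoints of the non-degenerate interval I in the definition of a useful set are rational. -}

module Defs where

open import Data.Nat using (ℕ; zero; suc; _∸_; _≤_; _<_)
open import Data.Integer using (+_)
open import Data.Rational using (ℚ; _/_; _+_; _*_; 0ℚ)
import Data.Rational as Q
open import Data.Bool using (Bool; true; false; _∧_; _∨_; not; T)
open import Data.Fin using (Fin; _≟_)
open import Data.Fin.Subset using (Subset; ∣_∣; ⊤)
open import Data.Vec using (tabulate; lookup)
open import Data.List using (allFin)
open import Data.Bool.ListAction using (any; all)
open import Data.Product using (Σ; _×_; ∃)
open import Relation.Nullary.Decidable using (⌊_⌋)
open import Relation.Binary.PropositionalEquality using (_≡_)

record Graph (n : ℕ) : Set where
  field
    adj   : Fin n → Fin n → Bool
    sym   : ∀ u v → adj u v ≡ adj v u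
    irref : ∀ v → adj v v ≡ false
open Graph public

module _ {n : ℕ} (G : Graph n) where

  anyV : (Fin n → Bool) → Bool
  anyV p = any p (allFin n)

  allV : (Fin n → Bool) → Bool
  allV p = all p (allFin n)

  closedNbhd : Subset n → Subset n
  closedNbhd S = tabulate λ v →
    anyV (λ u → lookup S u ∧ (⌊ u ≟ v ⌋ ∨ adj G u v))

  forcedBy : Subset n → Fin n → Fin n → Bool
  forcedBy X u v = lookup X u ∧ adj G u v ∧ not (lookup X v)
    ∧ allV (λ w → not (adj G u w) ∨ ⌊ w ≟ v ⌋ ∨ lookup X w)

  step : Subset n → Subset n
  step X = tabulate λ v → lookup X v ∨ anyV (λ u → forcedBy X u v)

  iter : ℕ → Subset n → Subset n
  iter zero X = X
  iter (suc k) X = iter k (step X)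

  -- Obs(G;S): n rounds suffice, since each productive round adds a vertex
  Obs : Subset n → Subset n
  Obs S = iter n (closedNbhd S)

  IsPowerDomNumber : ℕ → Set
  IsPowerDomNumber γ =
    (Σ (Subset n) λ S → ∣ S ∣ ≡ γ × Obs S ≡ ⊤) ×
    (∀ S → Obs S ≡ ⊤ → γ ≤ ∣ S ∣)

  IsMaxObs : ℕ → ℕ → Set
  IsMaxObs k m =
    (Σ (Subset n) λ S → ∣ S ∣ ≡ k × ∣ Obs S ∣ ≡ m) ×
    (∀ S → ∣ S ∣ ≡ k → ∣ Obs S ∣ ≤ m)

  cost : Subset n → ℚ → ℚ
  cost S β = (+ ∣ S ∣ / 1) + β * (+ (n ∸ ∣ Obs S ∣) / 1)

  IsBest : ℚ → Subset n → Set
  IsBest β S = ∀ T → cost S β Q.≤ cost T β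

  Useful : Subset n → Set
  Useful S = Σ ℚ λ a → Σ ℚ λ b → 0ℚ Q.≤ a × a Q.< b ×
    (∀ β → a Q.≤ β → β Q.≤ b → IsBest β S)

  UsefulSize : ℕ → Set
  UsefulSize k = Σ (Subset n) λ S → ∣ S ∣ ≡ k × Useful S

-- a / b as a rational; convention a/0 := 0 (never used: denominators are positive)
ratio : ℕ → ℕ → ℚ
ratio a zero = 0ℚ
ratio a (suc b) = + a / suc b

module Submission where

-- Among sets of size j ≤ γ the cheapest are those
-- observing m_j vertices, and no set of size beyond γ beats a power dominating set, so the least
-- cost is the least value of the profile p_j(β) = j + β (n − m_j) over 0 ≤ j ≤ γ. Since m is
-- strictly increasing up to γ (an unobserved vertex can always be added to a set), p_i ≤ p_j
-- holds for j < i exactly when β is at least the slope (i − j)/(m_i − m_j), and for j > i exactly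
-- when β is at most (j − i)/(m_j − m_i). So a size-i maxObs set is β-best precisely for β between
-- the largest slope below i and the smallest slope above i, and such β fill a non-degenerate
-- interval iff the former is smaller than the latter.

open import Defs hiding (sym)

module Observation where

  open import Data.Nat as ℕ using (ℕ; zero; suc; s≤s)
  open import Data.Bool using (Bool; T; _∧_; _∨_; not)
  open import Data.Bool.Properties using (T-≡; T-∧; T-∨)
  open import Data.Fin using (Fin; zero; suc; _≟_)
  open import Data.Fin.Subset using (Subset; inside; outside; _∈_; _∉_; _⊆_; _∪_; ⁅_⁆; ∣_∣)
  open import Data.Fin.Subset.Properties
    using (_∈?_; drop-there; drop-not-there; ∪-identityʳ; p⊂q⇒∣p∣<∣q∣; x∉p⇒x∈∁p; p⊆p∪q; q⊆p∪q; x∈⁅x⁆)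
  open import Data.Vec using (_∷_; here; lookup; tabulate)
  open import Data.Vec.Properties using (lookup-map; lookup∘tabulate; []=⇒lookup; lookup⇒[]=)
  open import Data.List using (allFin)
  import Data.List.Relation.Unary.All as All
  open import Data.List.Relation.Unary.All.Properties using (all⁺; all⁻)
  import Data.List.Relation.Unary.Any as Any
  open import Data.List.Relation.Unary.Any.Properties using (any⁺; any⁻)
  open import Data.List.Membership.Propositional using (lose)
  open import Data.List.Membership.Propositional.Properties using (∈-allFin)
  open import Data.Product as Product using (∃; _,_)
  open import Data.Sum as Sum using (inj₁; inj₂)
  open import Function using (_∘_; id)
  open import Function.Bundles using (_⇔_; mk⇔; Equivalence)
  open import Relation.Nullary using (yes; no; contradiction)
  open import Relation.Nullary.Decidable using (fromWitness; ⌊_⌋)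
  open import Relation.Binary.PropositionalEquality

  open Equivalence

  T-∧-monoˡ : ∀ {a a′ b} → (T a → T a′) → T (a ∧ b) → T (a′ ∧ b)
  T-∧-monoˡ f = from T-∧ ∘ Product.map₁ f ∘ to T-∧

  T-∨-monoʳ : ∀ a {b b′} → (T b → T b′) → T (a ∨ b) → T (a ∨ b′)
  T-∨-monoʳ _ f = from T-∨ ∘ Sum.map₂ f ∘ to T-∨

  module _ {n : ℕ} where

    ∈⇔T-lookup : ∀ {x : Fin n} {p} → x ∈ p ⇔ T (lookup p x)
    ∈⇔T-lookup {x} {p} = mk⇔ (from T-≡ ∘ []=⇒lookup) (lookup⇒[]= x p ∘ to T-≡)

    ∈-tabulate⇔ : ∀ {x} {f : Fin n → Bool} → x ∈ tabulate f ⇔ T (f x)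
    ∈-tabulate⇔ {x} {f} = subst (λ b → x ∈ tabulate f ⇔ T b) (lookup∘tabulate f x) ∈⇔T-lookup

    lookup-mono : ∀ {p q : Subset n} {x} → p ⊆ q → T (lookup p x) → T (lookup q x)
    lookup-mono p⊆q = to ∈⇔T-lookup ∘ p⊆q ∘ from ∈⇔T-lookup

    ∉⇒T-not-lookup : ∀ {p : Subset n} {x} → x ∉ p → T (not (lookup p x))
    ∉⇒T-not-lookup {p} {x} x∉p = subst T (lookup-map x not p) (to ∈⇔T-lookup (x∉p⇒x∈∁p x∉p))

  module _ {n : ℕ} (G : Graph n) where

    anyV-intro : ∀ {p} v → T (p v) → T (anyV G p)
    anyV-intro {p} v pv = any⁺ p (lose (∈-allFin v) pv)

    anyV-mono : ∀ {p q} → (∀ v → T (p v) → T (q v)) → T (anyV G p) → T (anyV G q)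
    anyV-mono {p} {q} p⇒q = any⁺ q ∘ Any.map (p⇒q _) ∘ any⁻ p (allFin n)

    allV-mono : ∀ {p q} → (∀ v → T (p v) → T (q v)) → T (allV G p) → T (allV G q)
    allV-mono {p} {q} p⇒q = all⁻ q ∘ All.map (p⇒q _) ∘ all⁺ p (allFin n)

    ⊆-closedNbhd : ∀ S → S ⊆ closedNbhd G S
    ⊆-closedNbhd S {v} v∈S = from ∈-tabulate⇔
      (anyV-intro v (from T-∧ (to ∈⇔T-lookup v∈S , from (T-∨ {⌊ v ≟ v ⌋}) (inj₁ (fromWitness refl)))))

    closedNbhd-mono : ∀ {S S′} → S ⊆ S′ → closedNbhd G S ⊆ closedNbhd G S′
    closedNbhd-mono S⊆S′ =
      from ∈-tabulate⇔ ∘ anyV-mono (λ _ → T-∧-monoˡ (lookup-mono S⊆S′)) ∘ to ∈-tabulate⇔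

    ⊆-step : ∀ X → X ⊆ step G X
    ⊆-step X = from ∈-tabulate⇔ ∘ from T-∨ ∘ inj₁ ∘ to ∈⇔T-lookup

    forcedBy-mono : ∀ {X Y u v} → X ⊆ Y → v ∉ Y → T (forcedBy G X u v) → T (forcedBy G Y u v)
    forcedBy-mono {X} {Y} {u} {v} X⊆Y v∉Y h =
      let Xu , h₁     = to (T-∧ {lookup X u}) h
          uv , h₂     = to (T-∧ {adj G u v}) h₁
          _  , unique = to (T-∧ {not (lookup X v)}) h₂
      in from T-∧ (lookup-mono X⊆Y Xu , from T-∧ (uv , from T-∧ (∉⇒T-not-lookup v∉Y ,
           allV-mono (λ w → T-∨-monoʳ (not (adj G u w)) (T-∨-monoʳ ⌊ w ≟ v ⌋ (lookup-mono X⊆Y))) unique)))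

    step-mono : ∀ {X Y} → X ⊆ Y → step G X ⊆ step G Y
    step-mono {X} {Y} X⊆Y {v} v∈stepX with v ∈? Y | to T-∨ (to ∈-tabulate⇔ v∈stepX)
    ... | yes v∈Y | _          = ⊆-step Y v∈Y
    ... | no  v∉Y | inj₁ Xv    = contradiction (X⊆Y (from ∈⇔T-lookup Xv)) v∉Y
    ... | no  v∉Y | inj₂ force =
      from ∈-tabulate⇔ (from T-∨ (inj₂ (anyV-mono (λ _ → forcedBy-mono X⊆Y v∉Y) force)))

    iter-mono : ∀ k {X Y} → X ⊆ Y → iter G k X ⊆ iter G k Y
    iter-mono zero    X⊆Y = X⊆Y
    iter-mono (suc k) X⊆Y = iter-mono k (step-mono X⊆Y)

    ⊆-iter : ∀ k X → X ⊆ iter G k X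
    ⊆-iter zero    X = id
    ⊆-iter (suc k) X = ⊆-iter k (step G X) ∘ ⊆-step X

    Obs-mono : ∀ {S S′} → S ⊆ S′ → Obs G S ⊆ Obs G S′
    Obs-mono = iter-mono n ∘ closedNbhd-mono

    ⊆-Obs : ∀ S → S ⊆ Obs G S
    ⊆-Obs S = ⊆-iter n (closedNbhd G S) ∘ ⊆-closedNbhd S

    ∣Obs∣<∣Obs-∪⁅x⁆∣ : ∀ S {x} → x ∉ Obs G S → ∣ Obs G S ∣ ℕ.< ∣ Obs G (S ∪ ⁅ x ⁆) ∣
    ∣Obs∣<∣Obs-∪⁅x⁆∣ S {x} x∉Obs = p⊂q⇒∣p∣<∣q∣
      (Obs-mono (p⊆p∪q {p = S} ⁅ x ⁆) , x , ⊆-Obs (S ∪ ⁅ x ⁆) (q⊆p∪q S ⁅ x ⁆ (x∈⁅x⁆ x)) , x∉Obs)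

  ∣p∪⁅x⁆∣≡1+∣p∣ : ∀ {n} {p : Subset n} {x} → x ∉ p → ∣ p ∪ ⁅ x ⁆ ∣ ≡ suc ∣ p ∣
  ∣p∪⁅x⁆∣≡1+∣p∣ {p = outside ∷ p} {zero}  _   = cong (suc ∘ ∣_∣) (∪-identityʳ p)
  ∣p∪⁅x⁆∣≡1+∣p∣ {p = inside  ∷ p} {zero}  x∉p = contradiction here x∉p
  ∣p∪⁅x⁆∣≡1+∣p∣ {p = outside ∷ p} {suc x} x∉p = ∣p∪⁅x⁆∣≡1+∣p∣ (drop-not-there x∉p)
  ∣p∪⁅x⁆∣≡1+∣p∣ {p = inside  ∷ p} {suc x} x∉p = cong suc (∣p∪⁅x⁆∣≡1+∣p∣ (drop-not-there x∉p))

  ∣p∣<n⇒∃∉ : ∀ {n} {p : Subset n} → ∣ p ∣ ℕ.< n → ∃ (_∉ p)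
  ∣p∣<n⇒∃∉ {p = outside ∷ p} _       = zero , λ ()
  ∣p∣<n⇒∃∉ {p = inside  ∷ p} (s≤s h) = let x , x∉p = ∣p∣<n⇒∃∉ h in suc x , x∉p ∘ drop-there

module CostArithmetic where

  open import Data.Nat as ℕ using (ℕ; zero; suc; _∸_)
  import Data.Nat.Properties as ℕ
  open import Data.Integer as ℤ using (+_)
  import Data.Integer.Properties as ℤ
  open import Data.Rational using (ℚ; _/_; 0ℚ; toℚᵘ; _+_; _*_; -_; _≤_; Positive; NonNegative; nonNegative)
  open import Data.Rational.Properties
  import Data.Rational.Unnormalised as ℚᵘ
  import Data.Rational.Unnormalised.Properties as ℚᵘ
  open import Data.Rational.Solver using (module +-*-Solver)
  open import Function.Bundles using (_⇔_; mk⇔)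
  open import Function.Properties.Equivalence using () renaming (trans to ⇔-trans; sym to ⇔-sym)
  open import Relation.Binary.PropositionalEquality

  fromℕ : ℕ → ℚ
  fromℕ x = + x / 1

  toℚᵘ-/ : ∀ i d → toℚᵘ (i / suc d) ℚᵘ.≃ ℚᵘ.mkℚᵘ i d
  toℚᵘ-/ i d = toℚᵘ-fromℚᵘ (ℚᵘ.mkℚᵘ i d)

  fromℕ-+ : ∀ x y → fromℕ (x ℕ.+ y) ≡ fromℕ x + fromℕ y
  fromℕ-+ x y = toℚᵘ-injective (begin
    toℚᵘ (fromℕ (x ℕ.+ y))                ≈⟨ toℚᵘ-/ (+ (x ℕ.+ y)) 0 ⟩
    ℚᵘ.mkℚᵘ (+ (x ℕ.+ y)) 0                ≈⟨ ℚᵘ.*≡* (cong (ℤ._* ℤ.1ℤ) numerators) ⟩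
    ℚᵘ.mkℚᵘ (+ x) 0 ℚᵘ.+ ℚᵘ.mkℚᵘ (+ y) 0    ≈⟨ ℚᵘ.+-cong (toℚᵘ-/ (+ x) 0) (toℚᵘ-/ (+ y) 0) ⟨
    toℚᵘ (fromℕ x) ℚᵘ.+ toℚᵘ (fromℕ y)      ≈⟨ toℚᵘ-homo-+ (fromℕ x) (fromℕ y) ⟨
    toℚᵘ (fromℕ x + fromℕ y)               ∎)
    where
    open ℚᵘ.≃-Reasoning
    numerators : + (x ℕ.+ y) ≡ + x ℤ.* ℤ.1ℤ ℤ.+ + y ℤ.* ℤ.1ℤ
    numerators = trans (ℤ.pos-+ x y) (sym (cong₂ ℤ._+_ (ℤ.*-identityʳ (+ x)) (ℤ.*-identityʳ (+ y))))

  fromℕ-mono-≤ : ∀ {x y} → x ℕ.≤ y → fromℕ x ≤ fromℕ y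
  fromℕ-mono-≤ {x} {y} x≤y = toℚᵘ-cancel-≤ (ℚᵘ.≤-respʳ-≃ (ℚᵘ.≃-sym (toℚᵘ-/ (+ y) 0))
    (ℚᵘ.≤-respˡ-≃ (ℚᵘ.≃-sym (toℚᵘ-/ (+ x) 0)) (ℚᵘ.*≤* (ℤ.*-monoʳ-≤-nonNeg ℤ.1ℤ (ℤ.+≤+ x≤y)))))

  fromℕ-pos : ∀ {d} → 0 ℕ.< d → Positive (fromℕ d)
  fromℕ-pos {suc d} _ = normalize-pos (suc d) 1

  ratio-*-fromℕ : ∀ e {d} → 0 ℕ.< d → ratio e d * fromℕ d ≡ fromℕ e
  ratio-*-fromℕ e {suc d} _ = toℚᵘ-injective (begin
    toℚᵘ (+ e / suc d * fromℕ (suc d))              ≈⟨ toℚᵘ-homo-* (+ e / suc d) (fromℕ (suc d)) ⟩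
    toℚᵘ (+ e / suc d) ℚᵘ.* toℚᵘ (fromℕ (suc d))     ≈⟨ ℚᵘ.*-cong (toℚᵘ-/ (+ e) d) (toℚᵘ-/ (+ suc d) 0) ⟩
    ℚᵘ.mkℚᵘ (+ e) d ℚᵘ.* ℚᵘ.mkℚᵘ (+ suc d) 0         ≈⟨ ℚᵘ.*≡* cross-products ⟩
    ℚᵘ.mkℚᵘ (+ e) 0                                 ≈⟨ toℚᵘ-/ (+ e) 0 ⟨
    toℚᵘ (fromℕ e)                                  ∎)
    where
    open ℚᵘ.≃-Reasoning
    cross-products : (+ e ℤ.* + suc d) ℤ.* ℤ.1ℤ ≡ + e ℤ.* + (suc d ℕ.* 1)
    cross-products = trans (ℤ.*-identityʳ _) (cong (λ k → + e ℤ.* + k) (sym (ℕ.*-identityʳ (suc d))))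

  *-fromℕ-≤⇔ : ∀ {d} p q → 0 ℕ.< d → (p ≤ q ⇔ p * fromℕ d ≤ q * fromℕ d)
  *-fromℕ-≤⇔ {d} p q 0<d = mk⇔ (*-monoʳ-≤-nonNeg (fromℕ d)) (*-cancelʳ-≤-pos (fromℕ d))
    where
    instance
      d-pos : Positive (fromℕ d)
      d-pos = fromℕ-pos 0<d
      d-nonNeg : NonNegative (fromℕ d)
      d-nonNeg = pos⇒nonNeg (fromℕ d)

  ratio≤⇔ : ∀ e {d} β → 0 ℕ.< d → (ratio e d ≤ β ⇔ fromℕ e ≤ β * fromℕ d)
  ratio≤⇔ e {d} β 0<d = subst (λ x → ratio e d ≤ β ⇔ x ≤ β * fromℕ d)
    (ratio-*-fromℕ e 0<d) (*-fromℕ-≤⇔ (ratio e d) β 0<d)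

  ≤ratio⇔ : ∀ e {d} β → 0 ℕ.< d → (β ≤ ratio e d ⇔ β * fromℕ d ≤ fromℕ e)
  ≤ratio⇔ e {d} β 0<d = subst (λ x → β ≤ ratio e d ⇔ β * fromℕ d ≤ x)
    (ratio-*-fromℕ e 0<d) (*-fromℕ-≤⇔ β (ratio e d) 0<d)

  0≤ratio : ∀ e d → 0ℚ ≤ ratio e d
  0≤ratio e zero    = ≤-refl
  0≤ratio e (suc d) = nonNegative⁻¹ (+ e / suc d) {{normalize-nonNeg e (suc d)}}

  +-cancelˡ-≤ : ∀ r {p q} → r + p ≤ r + q → p ≤ q
  +-cancelˡ-≤ r {p} {q} h = subst₂ _≤_ (-r+[r+x]≡x p) (-r+[r+x]≡x q) (+-monoʳ-≤ (- r) h)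
    where
    open +-*-Solver
    -r+[r+x]≡x : ∀ x → - r + (r + x) ≡ x
    -r+[r+x]≡x = solve 2 (λ r x → (:- r) :+ (r :+ x) := x) refl r

  +-cancelˡ-≤⇔ : ∀ r {p q} → (r + p ≤ r + q ⇔ p ≤ q)
  +-cancelˡ-≤⇔ r = mk⇔ (+-cancelˡ-≤ r) (+-monoʳ-≤ r)

  costOf : ℕ → ℕ → ℕ → ℚ → ℚ
  costOf n size observed β = fromℕ size + β * fromℕ (n ∸ observed)

  costOf-mono : ∀ n {x x′ o o′} β → 0ℚ ≤ β → x ℕ.≤ x′ → o′ ℕ.≤ o →
                costOf n x o β ≤ costOf n x′ o′ β
  costOf-mono n β 0≤β x≤x′ o′≤o = +-mono-≤ (fromℕ-mono-≤ x≤x′)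
    (*-monoˡ-≤-nonNeg β {{nonNegative 0≤β}} (fromℕ-mono-≤ (ℕ.∸-monoʳ-≤ n o′≤o)))

  fromℕ-∸-split : ∀ {x y} → y ℕ.≤ x → fromℕ x ≡ fromℕ y + fromℕ (x ∸ y)
  fromℕ-∸-split {x} {y} y≤x = trans (cong fromℕ (sym (ℕ.m+[n∸m]≡n y≤x))) (fromℕ-+ y (x ∸ y))

  ∸-split : ∀ {n p q} → p ℕ.≤ q → q ℕ.≤ n → n ∸ p ≡ (n ∸ q) ℕ.+ (q ∸ p)
  ∸-split {n} {p} {q} p≤q q≤n =
    trans (cong (_∸ p) (sym (ℕ.m∸n+n≡m q≤n))) (ℕ.+-∸-assoc (n ∸ q) p≤q)

  module _ (n : ℕ) {x y p q : ℕ} (β : ℚ) (y≤x : y ℕ.≤ x) (p≤q : p ℕ.≤ q) (q≤n : q ℕ.≤ n) where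
    open +-*-Solver

    private
      common : ℚ
      common = fromℕ y + β * fromℕ (n ∸ q)

      costOf-larger : costOf n x q β ≡ common + fromℕ (x ∸ y)
      costOf-larger = begin
        fromℕ x + β * fromℕ (n ∸ q)
          ≡⟨ cong (_+ β * fromℕ (n ∸ q)) (fromℕ-∸-split y≤x) ⟩
        fromℕ y + fromℕ (x ∸ y) + β * fromℕ (n ∸ q)
          ≡⟨ solve 4 (λ a b c d → a :+ b :+ c :* d := a :+ c :* d :+ b)
                   refl (fromℕ y) (fromℕ (x ∸ y)) β (fromℕ (n ∸ q)) ⟩
        common + fromℕ (x ∸ y)
          ∎
        where open ≡-Reasoning

      costOf-smaller : costOf n y p β ≡ common + β * fromℕ (q ∸ p)
      costOf-smaller = begin
        fromℕ y + β * fromℕ (n ∸ p)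
          ≡⟨ cong (λ k → fromℕ y + β * k) (trans (cong fromℕ (∸-split p≤q q≤n)) (fromℕ-+ (n ∸ q) (q ∸ p))) ⟩
        fromℕ y + β * (fromℕ (n ∸ q) + fromℕ (q ∸ p))
          ≡⟨ solve 4 (λ a b c d → a :+ b :* (c :+ d) := a :+ b :* c :+ b :* d)
                   refl (fromℕ y) β (fromℕ (n ∸ q)) (fromℕ (q ∸ p)) ⟩
        common + β * fromℕ (q ∸ p)
          ∎
        where open ≡-Reasoning

    cheaper-larger⇔ : p ℕ.< q → (costOf n x q β ≤ costOf n y p β ⇔ ratio (x ∸ y) (q ∸ p) ≤ β)
    cheaper-larger⇔ p<q = ⇔-trans
      (subst₂ (λ a b → a ≤ b ⇔ _) (sym costOf-larger) (sym costOf-smaller) (+-cancelˡ-≤⇔ common))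
      (⇔-sym (ratio≤⇔ (x ∸ y) β (ℕ.m<n⇒0<n∸m p<q)))

    cheaper-smaller⇔ : p ℕ.< q → (costOf n y p β ≤ costOf n x q β ⇔ β ≤ ratio (x ∸ y) (q ∸ p))
    cheaper-smaller⇔ p<q = ⇔-trans
      (subst₂ (λ a b → a ≤ b ⇔ _) (sym costOf-smaller) (sym costOf-larger) (+-cancelˡ-≤⇔ common))
      (⇔-sym (≤ratio⇔ (x ∸ y) β (ℕ.m<n⇒0<n∸m p<q)))

module FiniteExtrema where

  open import Data.Nat as ℕ using (ℕ; zero; suc; s≤s)
  import Data.Nat.Properties as ℕ
  open import Data.Rational using (ℚ; _≤_; _<_; _⊔_; _⊓_)
  open import Data.Rational.Properties
  open import Data.Sum using (inj₁; inj₂)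
  open import Relation.Binary.PropositionalEquality

  maxBelow : ℚ → (ℕ → ℚ) → ℕ → ℚ
  maxBelow c f zero    = c
  maxBelow c f (suc k) = maxBelow c f k ⊔ f k

  c≤maxBelow : ∀ c f k → c ≤ maxBelow c f k
  c≤maxBelow c f zero    = ≤-refl
  c≤maxBelow c f (suc k) = p≤q⇒p≤q⊔r (f k) (c≤maxBelow c f k)

  f≤maxBelow : ∀ c f {j} k → j ℕ.< k → f j ≤ maxBelow c f k
  f≤maxBelow c f (suc k) (s≤s j≤k) with ℕ.m≤n⇒m<n∨m≡n j≤k
  ... | inj₁ j<k  = p≤q⇒p≤q⊔r (f k) (f≤maxBelow c f k j<k)
  ... | inj₂ refl = p≤q⊔p (maxBelow c f k) (f k)

  maxBelow-< : ∀ {c f X} k → c < X → (∀ j → j ℕ.< k → f j < X) → maxBelow c f k < X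
  maxBelow-< zero c<X f<X = c<X
  maxBelow-< {c} {f} (suc k) c<X f<X with ⊔-sel (maxBelow c f k) (f k)
  ... | inj₁ eq = subst (_< _) (sym eq) (maxBelow-< k c<X (λ j j<k → f<X j (ℕ.m<n⇒m<1+n j<k)))
  ... | inj₂ eq = subst (_< _) (sym eq) (f<X k ℕ.≤-refl)

  minUpTo : (ℕ → ℚ) → ℕ → ℚ
  minUpTo g zero    = g 0
  minUpTo g (suc l) = minUpTo g l ⊓ g (suc l)

  minUpTo≤g : ∀ g {s} l → s ℕ.≤ l → minUpTo g l ≤ g s
  minUpTo≤g g zero    ℕ.z≤n = ≤-refl
  minUpTo≤g g (suc l) s≤1+l with ℕ.m≤n⇒m<n∨m≡n s≤1+l
  ... | inj₁ (s≤s s≤l) = p≤q⇒p⊓r≤q (g (suc l)) (minUpTo≤g g l s≤l)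
  ... | inj₂ refl      = p⊓q≤q (minUpTo g l) (g (suc l))

  <-minUpTo : ∀ {g X} l → (∀ s → s ℕ.≤ l → X < g s) → X < minUpTo g l
  <-minUpTo zero X<g = X<g 0 ℕ.z≤n
  <-minUpTo {g} (suc l) X<g with ⊓-sel (minUpTo g l) (g (suc l))
  ... | inj₁ eq = subst (_ <_) (sym eq) (<-minUpTo l (λ s s≤l → X<g s (ℕ.m≤n⇒m≤1+n s≤l)))
  ... | inj₂ eq = subst (_ <_) (sym eq) (X<g (suc l) ℕ.≤-refl)

open import Data.Nat using (ℕ; suc; _+_; _∸_; _≤_; _<_; s≤s)
import Data.Nat.Properties as ℕ
open import Data.Fin.Subset using (Subset; ∣_∣; _∪_; ⁅_⁆)
open import Data.Fin.Subset.Properties using (∣p∣≤n; ∣⊤∣≡n; ∣p∣≡n⇒p≡⊤)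
import Data.Rational as Q
open import Data.Rational using (0ℚ)
import Data.Rational.Properties as Q
open import Data.Product using (∃; _×_; _,_; proj₁; proj₂)
open import Data.Sum using (inj₁; inj₂)
open import Function using (_∘_)
open import Function.Bundles using (_⇔_; mk⇔; Equivalence)
open import Relation.Binary.Definitions using (tri<; tri≈; tri>)
open import Relation.Binary.PropositionalEquality
open import Relation.Nullary using (contradiction)

open Observation
open CostArithmetic
open FiniteExtrema
open Equivalence

module MaxObsProfile {n} (G : Graph n) (γ : ℕ) (m : ℕ → ℕ)
  (γ-isPD : IsPowerDomNumber G γ) (m-isMaxObs : ∀ j → j ≤ γ → IsMaxObs G j (m j)) where

  maxObs≤n : ∀ {j} → j ≤ γ → m j ≤ n
  maxObs≤n {j} j≤γ =
    let (S , _ , ∣ObsS∣≡mj) , _ = m-isMaxObs j j≤γ in subst (_≤ n) ∣ObsS∣≡mj (∣p∣≤n (Obs G S))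

  maxObs-γ≡n : m γ ≡ n
  maxObs-γ≡n =
    let S , ∣S∣≡γ , ObsS≡⊤ = proj₁ γ-isPD
        _ , m-isMax = m-isMaxObs γ ℕ.≤-refl
    in ℕ.≤-antisym (maxObs≤n ℕ.≤-refl)
         (subst (_≤ m γ) (trans (cong ∣_∣ ObsS≡⊤) (∣⊤∣≡n n)) (m-isMax S ∣S∣≡γ))

  maxObs-<-suc : ∀ {k} → suc k ≤ γ → m k < m (suc k)
  maxObs-<-suc {k} k<γ with m-isMaxObs k (ℕ.<⇒≤ k<γ)
  ... | (S , ∣S∣≡k , ∣ObsS∣≡mk) , _ with ℕ.m≤n⇒m<n∨m≡n (∣p∣≤n (Obs G S))
  ... | inj₂ ∣ObsS∣≡n =
    contradiction (subst (γ ≤_) ∣S∣≡k (proj₂ γ-isPD S (∣p∣≡n⇒p≡⊤ ∣ObsS∣≡n))) (ℕ.<⇒≱ k<γ)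
  ... | inj₁ ∣ObsS∣<n =
    let v , v∉ObsS = ∣p∣<n⇒∃∉ ∣ObsS∣<n
        _ , m-isMax = m-isMaxObs (suc k) k<γ
        ∣S∪v∣≡1+k = trans (∣p∪⁅x⁆∣≡1+∣p∣ (v∉ObsS ∘ ⊆-Obs G S)) (cong suc ∣S∣≡k)
    in subst (_< m (suc k)) ∣ObsS∣≡mk
         (ℕ.<-≤-trans (∣Obs∣<∣Obs-∪⁅x⁆∣ G S v∉ObsS) (m-isMax (S ∪ ⁅ v ⁆) ∣S∪v∣≡1+k))

  maxObs-strictMono : ∀ {j k} → j < k → k ≤ γ → m j < m k
  maxObs-strictMono {j} {suc k} (s≤s j≤k) k<γ with ℕ.m≤n⇒m<n∨m≡n j≤k
  ... | inj₁ j<k  = ℕ.<-trans (maxObs-strictMono j<k (ℕ.<⇒≤ k<γ)) (maxObs-<-suc k<γ)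
  ... | inj₂ refl = maxObs-<-suc k<γ

  profile : ℕ → Q.ℚ → Q.ℚ
  profile j β = costOf n j (m j) β

  slope : ℕ → ℕ → Q.ℚ
  slope j k = ratio (k ∸ j) (m k ∸ m j)

  maxObsSet : ∀ {j} → j ≤ γ → Subset n
  maxObsSet {j} j≤γ = proj₁ (proj₁ (m-isMaxObs j j≤γ))

  ∣maxObsSet∣ : ∀ {j} (j≤γ : j ≤ γ) → ∣ maxObsSet j≤γ ∣ ≡ j
  ∣maxObsSet∣ {j} j≤γ = proj₁ (proj₂ (proj₁ (m-isMaxObs j j≤γ)))

  cost-maxObsSet : ∀ {j} (j≤γ : j ≤ γ) β → cost G (maxObsSet j≤γ) β ≡ profile j β
  cost-maxObsSet {j} j≤γ β =
    cong₂ (λ x o → costOf n x o β) (∣maxObsSet∣ j≤γ) (proj₂ (proj₂ (proj₁ (m-isMaxObs j j≤γ))))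

  profile-≤-cost : ∀ {β j} → 0ℚ Q.≤ β → j ≤ γ → ∀ T → ∣ T ∣ ≡ j → profile j β Q.≤ cost G T β
  profile-≤-cost {β} {j} 0≤β j≤γ T refl =
    costOf-mono n {j} {j} {m j} {∣ Obs G T ∣} β 0≤β ℕ.≤-refl (proj₂ (m-isMaxObs j j≤γ) T refl)

  profile-below-cost : ∀ {β} → 0ℚ Q.≤ β → ∀ T → ∃ λ j → j ≤ γ × profile j β Q.≤ cost G T β
  profile-below-cost {β} 0≤β T with ℕ.≤-total ∣ T ∣ γ
  ... | inj₁ ∣T∣≤γ = ∣ T ∣ , ∣T∣≤γ , profile-≤-cost 0≤β ∣T∣≤γ T refl
  ... | inj₂ γ≤∣T∣ = γ , ℕ.≤-refl , costOf-mono n β 0≤β γ≤∣T∣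
                       (subst (∣ Obs G T ∣ ≤_) (sym maxObs-γ≡n) (∣p∣≤n (Obs G T)))

  profile-≤-below⇔ : ∀ {i j} β → j < i → i ≤ γ → (profile i β Q.≤ profile j β ⇔ slope j i Q.≤ β)
  profile-≤-below⇔ β j<i i≤γ = let mj<mi = maxObs-strictMono j<i i≤γ in
    cheaper-larger⇔ n β (ℕ.<⇒≤ j<i) (ℕ.<⇒≤ mj<mi) (maxObs≤n i≤γ) mj<mi

  profile-≤-above⇔ : ∀ {i k} β → i < k → k ≤ γ → (profile i β Q.≤ profile k β ⇔ β Q.≤ slope i k)
  profile-≤-above⇔ β i<k k≤γ = let mi<mk = maxObs-strictMono i<k k≤γ in
    cheaper-smaller⇔ n β (ℕ.<⇒≤ i<k) (ℕ.<⇒≤ mi<mk) (maxObs≤n k≤γ) mi<mk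

  best⇒profile-min : ∀ {β S i} → 0ℚ Q.≤ β → IsBest G β S → ∣ S ∣ ≡ i → i ≤ γ →
                     ∀ {j} → j ≤ γ → profile i β Q.≤ profile j β
  best⇒profile-min {β} {S} 0≤β best ∣S∣≡i i≤γ j≤γ =
    Q.≤-trans (profile-≤-cost 0≤β i≤γ S ∣S∣≡i)
      (subst (cost G S β Q.≤_) (cost-maxObsSet j≤γ β) (best (maxObsSet j≤γ)))

  profile-min⇒best : ∀ {β i} → 0ℚ Q.≤ β → (i≤γ : i ≤ γ) →
                     (∀ {j} → j ≤ γ → profile i β Q.≤ profile j β) → IsBest G β (maxObsSet i≤γ)
  profile-min⇒best {β} 0≤β i≤γ min T =
    let _ , j≤γ , profile-j≤cost = profile-below-cost 0≤β T in
    subst (Q._≤ cost G T β) (sym (cost-maxObsSet i≤γ β)) (Q.≤-trans (min j≤γ) profile-j≤cost)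

  Separated : ℕ → Set
  Separated i = ∀ j k → j < i → i < k → k ≤ γ → slope j i Q.< slope i k

  usefulSize⇒separated : ∀ {i} → i ≤ γ → UsefulSize G i → Separated i
  usefulSize⇒separated {i} i≤γ (S , ∣S∣≡i , a , b , 0≤a , a<b , best) j k j<i i<k k≤γ =
    Q.≤-<-trans slope≤a (Q.<-≤-trans a<b b≤slope)
    where
    min-at : ∀ β → a Q.≤ β → β Q.≤ b → ∀ {l} → l ≤ γ → profile i β Q.≤ profile l β
    min-at β a≤β β≤b = best⇒profile-min {S = S} (Q.≤-trans 0≤a a≤β) (best β a≤β β≤b) ∣S∣≡i i≤γ

    slope≤a : slope j i Q.≤ a
    slope≤a = to (profile-≤-below⇔ a j<i i≤γ)
      (min-at a Q.≤-refl (Q.<⇒≤ a<b) (ℕ.≤-trans (ℕ.<⇒≤ j<i) i≤γ))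

    b≤slope : b Q.≤ slope i k
    b≤slope = to (profile-≤-above⇔ b i<k k≤γ) (min-at b (Q.<⇒≤ a<b) Q.≤-refl k≤γ)

  separated⇒usefulSize : ∀ {i} → 1 ≤ i → i < γ → Separated i → UsefulSize G i
  separated⇒usefulSize {i} 0<i i<γ sep =
    maxObsSet i≤γ , ∣maxObsSet∣ i≤γ , a , b , 0≤a , a<b ,
    λ β a≤β β≤b → profile-min⇒best (Q.≤-trans 0≤a a≤β) i≤γ (profile-min β a≤β β≤b)
    where
    i≤γ = ℕ.<⇒≤ i<γ
    l = γ ∸ suc i

    above : ℕ → Q.ℚ
    above s = slope i (suc i + s)

    a = maxBelow 0ℚ (λ j → slope j i) i
    b = minUpTo above l

    0≤a : 0ℚ Q.≤ a
    0≤a = c≤maxBelow 0ℚ (λ j → slope j i) i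

    sep-above : ∀ {j} s → j < i → s ≤ l → slope j i Q.< above s
    sep-above s j<i s≤l = sep _ _ j<i (s≤s (ℕ.m≤m+n i s))
      (ℕ.≤-trans (ℕ.+-monoʳ-≤ (suc i) s≤l) (ℕ.≤-reflexive (ℕ.m+[n∸m]≡n i<γ)))

    a<b : a Q.< b
    a<b = maxBelow-< i (<-minUpTo l λ s s≤l → Q.≤-<-trans (0≤ratio i (m i ∸ m 0)) (sep-above s 0<i s≤l))
                       (λ j j<i → <-minUpTo l λ s → sep-above s j<i)

    b≤slope : ∀ {k} → i < k → k ≤ γ → b Q.≤ slope i k
    b≤slope i<k k≤γ = subst (λ k → b Q.≤ slope i k) (ℕ.m+[n∸m]≡n i<k)
      (minUpTo≤g above l (ℕ.∸-monoˡ-≤ (suc i) k≤γ))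

    profile-min : ∀ β → a Q.≤ β → β Q.≤ b → ∀ {k} → k ≤ γ → profile i β Q.≤ profile k β
    profile-min β a≤β β≤b {k} k≤γ with ℕ.<-cmp k i
    ... | tri< k<i _ _  = from (profile-≤-below⇔ β k<i i≤γ)
                            (Q.≤-trans (f≤maxBelow 0ℚ (λ j → slope j i) i k<i) a≤β)
    ... | tri≈ _ refl _ = Q.≤-refl
    ... | tri> _ _ i<k  = from (profile-≤-above⇔ β i<k k≤γ) (Q.≤-trans β≤b (b≤slope i<k k≤γ))

lemma2p6 : ∀ {n} (G : Graph n) (γ : ℕ) (m : ℕ → ℕ) →
    IsPowerDomNumber G γ →
    (∀ j → j ≤ γ → IsMaxObs G j (m j)) →
    ∀ i → 1 ≤ i → i < γ →
    (UsefulSize G i ⇔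
      (∀ j j′ → j < i → i < j′ → j′ ≤ γ →
        ratio (i ∸ j) (m i ∸ m j) Q.< ratio (j′ ∸ i) (m j′ ∸ m i)))
lemma2p6 G γ m γ-isPD m-isMaxObs i 0<i i<γ =
  mk⇔ (usefulSize⇒separated (ℕ.<⇒≤ i<γ)) (separated⇒usefulSize 0<i i<γ)
  where open MaxObsProfile G γ m γ-isPD m-isMaxObs
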